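{- Let $m,n\ge 3$ be integers, let $G=T^f[m,n]$ be the triangular lattice network with free boundary condition (defined in the context), and write $N=3(mn+7)-8(m+n)$. Then (i) $M_1(G)=12N+56(m+n-5)+70$; (ii) $M_2(G)=36N+128(m+n-5)+116$; (iii) $F(G)=72N+272(m+n-5)+270$; (iv) $ReZM(G)=432N+1216(m+n-5)+852$; (v) for every real $a\ne0,1$, $M^a(G)=2N\cdot 6^{a-1}+2(3^{a-1}+6^{a-1})+4(3^{a-1}+4^{a-1})+4(2^{a-1}+2^{2(a-1)})+(m+n-5)[2^{2a}+4(4^{a-1}+6^{a-1})]$; (vi) for every real $a\neq0$, $R_a(G)=N\cdot 6^{2a}+4\cdot 2^{3a}+(m+n-5)2^{4a+1}+2\cdot3^a6^a+4(m+n-5)4^a6^a+4\cdot 3^a4^a$; (vii) $SDD(G)=2N+\frac{38}{3}(m+n-5)+\frac{70}{3}$.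
   Context: For a simple graph $G$ with vertex degrees $d(v)$: $M_1(G)=\sum_{v\in V(G)}d(v)^2$; $M_2(G)=\sum_{uv\in E(G)}d(u)d(v)$; $F(G)=\sum_{v\in V(G)}d(v)^3$; $ReZM(G)=\sum_{uv\in E(G)}d(u)d(v)(d(u)+d(v))$; for real $a\ne0,1$, $M^a(G)=\sum_{v\in V(G)}d(v)^a$; for real $a\neq0$, $R_a(G)=\sum_{uv\in E(G)}(d(u)d(v))^a$; $SDD(G)=\sum_{uv\in E(G)}\big(\frac{d(u)}{d(v)}+\frac{d(v)}{d(u)}\big)$. The triangular lattice network with free boundary condition $T^f[m,n]$ is the graph with vertex set $\{(i,j):1\le i\le m,\ 1\le j\le n\}$ and edges $(i,j)(i,j+1)$ for $1\le i\le m$, $1\le j\le n-1$; $(i,j)(i+1,j)$ for $1\le i\le m-1$, $1\le j\le n$; and $(i,j)(i+1,j+1)$ for $1\le i\le m-1$, $1\le j\le n-1$. -}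

module Defs where

open import Level using (Level; _⊔_)
open import Data.Nat as ℕ using (ℕ; zero; suc; _≡ᵇ_; _≤_; NonZero)
open import Data.Integer as ℤ using (ℤ; +_; -[1+_])
open import Data.Rational as ℚ using (ℚ)
open import Data.List using (List; []; _∷_; map; concatMap; _++_; upTo; foldr)
open import Data.Product using (_×_; _,_; proj₁; proj₂)
open import Data.Bool using (Bool; true; false; _∧_; _∨_; if_then_else_)
open import Algebra.Bundles using (CommutativeRing)
open import Relation.Nullary using (¬_)

Vertex : Set
Vertex = ℕ × ℕ

Edge : Set
Edge = Vertex × Vertex

record Graph : Set where
  field
    verts : List Vertex
    edges : List Edge
open Graph public

_=ᵥ_ : Vertex → Vertex → Bool
(i , j) =ᵥ (k , l) = (i ≡ᵇ k) ∧ (j ≡ᵇ l)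

sumℕ : List ℕ → ℕ
sumℕ = foldr ℕ._+_ 0

deg : Graph → Vertex → ℕ
deg G v = sumℕ (map (λ e → if (v =ᵥ proj₁ e) ∨ (v =ᵥ proj₂ e) then 1 else 0) (edges G))

range : ℕ → ℕ → List ℕ
range a k = map (a ℕ.+_) (upTo k)

Tf : ℕ → ℕ → Graph
Tf m n = record
  { verts = concatMap (λ i → map (λ j → (i , j)) (range 1 n)) (range 1 m)
  ; edges =
      concatMap (λ i → map (λ j → ((i , j) , (i , suc j))) (range 1 (n ℕ.∸ 1))) (range 1 m)
   ++ concatMap (λ i → map (λ j → ((i , j) , (suc i , j))) (range 1 n)) (range 1 (m ℕ.∸ 1))
   ++ concatMap (λ i → map (λ j → ((i , j) , (suc i , suc j))) (range 1 (n ℕ.∸ 1))) (range 1 (m ℕ.∸ 1))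
  }

M₁ : Graph → ℕ
M₁ G = sumℕ (map (λ v → deg G v ℕ.^ 2) (verts G))

M₂ : Graph → ℕ
M₂ G = sumℕ (map (λ e → deg G (proj₁ e) ℕ.* deg G (proj₂ e)) (edges G))

Fidx : Graph → ℕ
Fidx G = sumℕ (map (λ v → deg G v ℕ.^ 3) (verts G))

ReZM : Graph → ℕ
ReZM G = sumℕ (map (λ e → let x = deg G (proj₁ e) ; y = deg G (proj₂ e)
                           in x ℕ.* y ℕ.* (x ℕ.+ y)) (edges G))

-- Symmetric division deg index (rational valued).
-- frac x y = x / y ; the y = 0 case never occurs for endpoints of edges.

frac : ℕ → ℕ → ℚ
frac x zero    = ℚ.0ℚ
frac x (suc y) = (+ x) ℚ./ suc y

SDD : Graph → ℚ
SDD G = foldr ℚ._+_ ℚ.0ℚ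
  (map (λ e → let x = deg G (proj₁ e) ; y = deg G (proj₂ e)
              in frac x y ℚ.+ frac y x) (edges G))

-- Real exponentiation, axiomatised (no reals in agda-stdlib).
-- A commutative ring (intended: ℝ) together with x ↦ x^a for positive
-- integer bases x and exponents a in the ring, satisfying the exponent laws.

module _ {c ℓ : Level} (R : CommutativeRing c ℓ) where
  open CommutativeRing R

  fromℕ : ℕ → Carrier
  fromℕ zero    = 0#
  fromℕ (suc k) = 1# + fromℕ k

  record ExpStructure : Set (c ⊔ ℓ) where
    field
      pow      : ℕ → Carrier → Carrier
      pow-cong : ∀ x {a b} → a ≈ b → pow x a ≈ pow x b
      pow-+    : ∀ x → .{{NonZero x}} → ∀ a b → pow x (a + b) ≈ pow x a * pow x b
      pow-1    : ∀ x → .{{NonZero x}} → pow x 1# ≈ fromℕ x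
      pow-*    : ∀ x y → .{{NonZero x}} → .{{NonZero y}} → ∀ a →
                 pow (x ℕ.* y) a ≈ pow x a * pow y a

module ExpOps {c ℓ} (R : CommutativeRing c ℓ) (X : ExpStructure R) where
  open CommutativeRing R
  open ExpStructure X

  fromℕᴿ : ℕ → Carrier
  fromℕᴿ = fromℕ R

  _−_ : Carrier → Carrier → Carrier
  x − y = x + (- y)

  fromℤ : ℤ → Carrier
  fromℤ (+ k)      = fromℕ R k
  fromℤ -[1+ k ]   = - fromℕ R (suc k)

  sumR : List Carrier → Carrier
  sumR = foldr _+_ 0#

  Mᵃ : Carrier → Graph → Carrier
  Mᵃ a G = sumR (map (λ v → pow (deg G v) a) (verts G))

  Rₐ : Carrier → Graph → Carrier
  Rₐ a G = sumR (map (λ e → pow (deg G (proj₁ e) ℕ.* deg G (proj₂ e)) a) (edges G))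

Nℤ : ℕ → ℕ → ℤ
Nℤ m n = + 3 ℤ.* (+ (m ℕ.* n) ℤ.+ + 7) ℤ.- + 8 ℤ.* (+ m ℤ.+ + n)

S5 : ℕ → ℕ → ℤ
S5 m n = + m ℤ.+ + n ℤ.- + 5

-- The degree of a vertex (i , j) of T^f[m,n] only depends on whether i is the first, a middle
-- or the last of 1..m, and likewise for j: it is 3 at (1,1) and (m,n), 2 at (1,n) and (m,1),
-- 4 on the rest of the boundary and 6 inside.  Hence a sum of any function of the degrees over
-- the vertices, or of the degree pair over the edges, collapses to a linear combination of class
-- sizes: 2, 2, 2(m+n-4) and (m-2)(n-2) vertices of degree 2, 3, 4, 6, and 4, 4, 2, 2s, 4s, N
-- edges of type {2,4}, {3,4}, {3,6}, {4,4}, {4,6}, {6,6}, where s = m+n-5.  Proving this once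
-- for sums in an arbitrary commutative semiring, every index is an instance followed by a
-- polynomial identity.

module Submission where

open import Defs
open import Level using (Level)
open import Data.Nat as ℕ using (ℕ; zero; suc; _≤_; _<_; _≡ᵇ_; _∸_; z≤n; s≤s; NonZero)
import Data.Nat.Properties as ℕₚ
open import Data.Integer as ℤ using (ℤ; +_)
import Data.Integer.Properties as ℤₚ
open import Data.Rational as ℚ using (ℚ)
import Data.Rational.Properties as ℚₚ
open import Data.Bool using (Bool; true; false; T; _∧_; _∨_; if_then_else_)
open import Data.List using (List; []; _∷_; map; concatMap; _++_; upTo; applyUpTo; foldr)
import Data.List.Properties as Listₚ
open import Data.Product using (_×_; _,_; proj₁; proj₂)
open import Data.Sum as Sum using (_⊎_; inj₁; inj₂)
open import Data.Empty using (⊥-elim)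
open import Function using (id; _∘_)
import Relation.Binary.PropositionalEquality as ≡
open ≡ using (_≡_; _≢_; refl; cong; cong₂)
open import Relation.Nullary using (¬_; yes; no)
open import Algebra.Bundles using (CommutativeSemiring; CommutativeRing)
import Algebra.Solver.Ring.NaturalCoefficients.Default as NaturalCoefficients
import Data.Nat.Solver
import Data.Integer.Solver
import Data.Rational.Solver
import Data.Nat.Coprimality as Coprimality

range-suc : ∀ a k → range a (suc k) ≡ a ∷ range (suc a) k
range-suc a k = cong₂ _∷_ (ℕₚ.+-identityʳ a) (begin
    map (a ℕ.+_) (applyUpTo suc k)     ≡⟨ cong (map (a ℕ.+_)) (≡.sym (Listₚ.map-upTo suc k)) ⟩
    map (a ℕ.+_) (map suc (upTo k))    ≡⟨ ≡.sym (Listₚ.map-∘ (upTo k)) ⟩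
    map (λ i → a ℕ.+ suc i) (upTo k)   ≡⟨ Listₚ.map-cong (ℕₚ.+-suc a) (upTo k) ⟩
    range (suc a) k                    ∎)
  where open ≡.≡-Reasoning

range-∷ʳ : ∀ a k → range a (suc k) ≡ range a k ++ (a ℕ.+ k ∷ [])
range-∷ʳ a k = ≡.trans (cong (map (a ℕ.+_)) (≡.sym (Listₚ.upTo-∷ʳ k)))
                       (Listₚ.map-++ (a ℕ.+_) (upTo k) (k ∷ []))

module ListSum {c ℓ} (S : CommutativeSemiring c ℓ) where
  open CommutativeSemiring S renaming (refl to ≈-refl)
  open import Relation.Binary.Reasoning.Setoid setoid
  import Algebra.Properties.Semiring.Mult semiring as Mult
  open import Algebra.Properties.CommutativeSemigroup +-commutativeSemigroup using () renaming (interchange to +-interchange)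
  open NaturalCoefficients S using (Polynomial; con; _:+_)

  nat : ℕ → Carrier
  nat k = k Mult.× 1#

  -- The solver reads  con k  as the optimised  k ×′ 1#,  which is not
  -- definitionally  nat k  for k ≥ 2; natP k is.
  natP : ∀ {n} → ℕ → Polynomial n
  natP zero    = con 0
  natP (suc k) = con 1 :+ natP k

  nat-+ : ∀ j k → nat (j ℕ.+ k) ≈ nat j + nat k
  nat-+ = Mult.×-homo-+ 1#

  nat-* : ∀ j k → nat (j ℕ.* k) ≈ nat j * nat k
  nat-* = Mult.×1-homo-*

  sumMap : {A : Set} → (A → Carrier) → List A → Carrier
  sumMap f xs = foldr _+_ 0# (map f xs)

  sumMap-cong : ∀ {A : Set} {f g : A → Carrier} xs → (∀ x → f x ≈ g x) → sumMap f xs ≈ sumMap g xs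
  sumMap-cong []       f≈g = ≈-refl
  sumMap-cong (x ∷ xs) f≈g = +-cong (f≈g x) (sumMap-cong xs f≈g)

  sumMap-++ : ∀ {A : Set} (f : A → Carrier) xs ys → sumMap f (xs ++ ys) ≈ sumMap f xs + sumMap f ys
  sumMap-++ f []       ys = sym (+-identityˡ _)
  sumMap-++ f (x ∷ xs) ys = trans (+-congˡ (sumMap-++ f xs ys)) (sym (+-assoc _ _ _))

  sumMap-map : ∀ {A B : Set} (f : B → Carrier) (g : A → B) xs → sumMap f (map g xs) ≈ sumMap (f ∘ g) xs
  sumMap-map f g xs = reflexive (cong (foldr _+_ 0#) (≡.sym (Listₚ.map-∘ xs)))

  sumMap-concatMap : ∀ {A B : Set} (f : B → Carrier) (g : A → List B) xs →
                     sumMap f (concatMap g xs) ≈ sumMap (sumMap f ∘ g) xs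
  sumMap-concatMap f g []       = ≈-refl
  sumMap-concatMap f g (x ∷ xs) = trans (sumMap-++ f (g x) (concatMap g xs)) (+-congˡ (sumMap-concatMap f g xs))

  sumMap-+ : ∀ {A : Set} (f g : A → Carrier) xs → sumMap (λ x → f x + g x) xs ≈ sumMap f xs + sumMap g xs
  sumMap-+ f g []       = sym (+-identityˡ 0#)
  sumMap-+ f g (x ∷ xs) = trans (+-congˡ (sumMap-+ f g xs)) (+-interchange (f x) (g x) _ _)

  sumMap-*ˡ : ∀ {A : Set} u (f : A → Carrier) xs → sumMap (λ x → u * f x) xs ≈ u * sumMap f xs
  sumMap-*ˡ u f []       = sym (zeroʳ u)
  sumMap-*ˡ u f (x ∷ xs) = trans (+-congˡ (sumMap-*ˡ u f xs)) (sym (distribˡ u _ _))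

  sumMap-*ʳ : ∀ {A : Set} u (f : A → Carrier) xs → sumMap (λ x → f x * u) xs ≈ sumMap f xs * u
  sumMap-*ʳ u f []       = sym (zeroˡ u)
  sumMap-*ʳ u f (x ∷ xs) = trans (+-congˡ (sumMap-*ʳ u f xs)) (sym (distribʳ u _ _))

  sumMap-range-suc : ∀ (f : ℕ → Carrier) a k → sumMap f (range a (suc k)) ≈ f a + sumMap f (range (suc a) k)
  sumMap-range-suc f a k = reflexive (cong (sumMap f) (range-suc a k))

  sumMap-range-ends : ∀ (f : ℕ → Carrier) a k →
                      sumMap f (range a (2 ℕ.+ k)) ≈ f a + sumMap f (range (suc a) k) + f (suc a ℕ.+ k)
  sumMap-range-ends f a k = begin
    sumMap f (range a (2 ℕ.+ k))                                ≈⟨ sumMap-range-suc f a (suc k) ⟩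
    f a + sumMap f (range (suc a) (suc k))
      ≈⟨ +-congˡ (reflexive (cong (sumMap f) (range-∷ʳ (suc a) k))) ⟩
    f a + sumMap f (range (suc a) k ++ (suc a ℕ.+ k ∷ []))      ≈⟨ +-congˡ (sumMap-++ f (range (suc a) k) _) ⟩
    f a + (sumMap f (range (suc a) k) + (f (suc a ℕ.+ k) + 0#)) ≈⟨ +-congˡ (+-congˡ (+-identityʳ _)) ⟩
    f a + (sumMap f (range (suc a) k) + f (suc a ℕ.+ k))        ≈⟨ +-assoc _ _ _ ⟨
    f a + sumMap f (range (suc a) k) + f (suc a ℕ.+ k)          ∎

  sumMap-range-const : ∀ (f : ℕ → Carrier) {z} a k → (∀ i → a ≤ i → i < a ℕ.+ k → f i ≈ z) →
                       sumMap f (range a k) ≈ nat k * z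
  sumMap-range-const f {z} a zero    f≈z = sym (zeroˡ z)
  sumMap-range-const f {z} a (suc k) f≈z = begin
    sumMap f (range a (suc k))          ≈⟨ sumMap-range-suc f a k ⟩
    f a + sumMap f (range (suc a) k)    ≈⟨ +-cong (f≈z a ℕₚ.≤-refl (ℕₚ.m<m+n a (s≤s z≤n)))
                                                  (sumMap-range-const f (suc a) k f≈z′) ⟩
    z + nat k * z                       ≈⟨ +-congʳ (*-identityˡ z) ⟨
    1# * z + nat k * z                  ≈⟨ distribʳ z 1# (nat k) ⟨
    nat (suc k) * z                     ∎
    where
    f≈z′ : ∀ i → suc a ≤ i → i < suc a ℕ.+ k → f i ≈ z
    f≈z′ i a<i i<a+k = f≈z i (ℕₚ.<⇒≤ a<i) (≡.subst (i <_) (≡.sym (ℕₚ.+-suc a k)) i<a+k)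

module ℕΣ = ListSum ℕₚ.+-*-commutativeSemiring

ind : Bool → ℕ
ind b = if b then 1 else 0

ind-∧ : ∀ x y → ind (x ∧ y) ≡ ind x ℕ.* ind y
ind-∧ true  true  = refl
ind-∧ true  false = refl
ind-∧ false y     = refl

ind-∨-∧ : ∀ x y x′ y′ → (x ∧ x′ ≡ false) ⊎ (y ∧ y′ ≡ false) →
          ind ((x ∧ y) ∨ (x′ ∧ y′)) ≡ ind x ℕ.* ind y ℕ.+ ind x′ ℕ.* ind y′
ind-∨-∧ true  true  true  true  (inj₁ ())
ind-∨-∧ true  true  true  true  (inj₂ ())
ind-∨-∧ true  true  true  false _ = refl
ind-∨-∧ true  true  false y′    _ = refl
ind-∨-∧ true  false x′    y′    _ = ind-∧ x′ y′
ind-∨-∧ false y     x′    y′    _ = ind-∧ x′ y′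

≡ᵇ-refl : ∀ p → (p ≡ᵇ p) ≡ true
≡ᵇ-refl zero    = refl
≡ᵇ-refl (suc p) = ≡ᵇ-refl p

≢⇒≡ᵇ≡false : ∀ p i → p ≢ i → (p ≡ᵇ i) ≡ false
≢⇒≡ᵇ≡false p i p≢i with p ≡ᵇ i in eq
... | false = refl
... | true  = ⊥-elim (p≢i (ℕₚ.≡ᵇ⇒≡ p i (≡.subst T (≡.sym eq) _)))

≡ᵇ-suc-disjoint : ∀ p i → (p ≡ᵇ i) ∧ (p ≡ᵇ suc i) ≡ false
≡ᵇ-suc-disjoint zero    zero    = refl
≡ᵇ-suc-disjoint zero    (suc i) = refl
≡ᵇ-suc-disjoint (suc p) zero    = refl
≡ᵇ-suc-disjoint (suc p) (suc i) = ≡ᵇ-suc-disjoint p i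

occurrences : (ℕ → ℕ) → List ℕ → ℕ → ℕ
occurrences f is p = ℕΣ.sumMap (λ i → ind (p ≡ᵇ f i)) is

occurrences-range-∉ : ∀ {p} a k → p < a ⊎ a ℕ.+ k ≤ p → occurrences id (range a k) p ≡ 0
occurrences-range-∉ a zero    _  = refl
occurrences-range-∉ {p} a (suc k) p∉ =
  ≡.trans (ℕΣ.sumMap-range-suc _ a k)
          (cong₂ ℕ._+_ (cong ind (≢⇒≡ᵇ≡false p a p≢a)) (occurrences-range-∉ (suc a) k p∉′))
  where
  p≢a : p ≢ a
  p≢a = Sum.[ ℕₚ.<⇒≢ , (λ a+k≤p → ℕₚ.>⇒≢ (ℕₚ.<-≤-trans (ℕₚ.m<m+n a (s≤s z≤n)) a+k≤p)) ] p∉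
  p∉′ : p < suc a ⊎ suc a ℕ.+ k ≤ p
  p∉′ = Sum.map ℕₚ.m<n⇒m<1+n (≡.subst (_≤ p) (ℕₚ.+-suc a k)) p∉

occurrences-range-∈ : ∀ {p} a k → a ≤ p → p < a ℕ.+ k → occurrences id (range a k) p ≡ 1
occurrences-range-∈ a zero a≤p p<a+0 =
  ⊥-elim (ℕₚ.<-irrefl refl (ℕₚ.≤-<-trans a≤p (≡.subst (_ <_) (ℕₚ.+-identityʳ a) p<a+0)))
occurrences-range-∈ {p} a (suc k) a≤p p<a+k with p ℕ.≟ a
... | yes refl = ≡.trans (ℕΣ.sumMap-range-suc _ a k)
                   (cong₂ ℕ._+_ (cong ind (≡ᵇ-refl a)) (occurrences-range-∉ (suc a) k (inj₁ (ℕₚ.n<1+n a))))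
... | no p≢a   = ≡.trans (ℕΣ.sumMap-range-suc _ a k)
                   (cong₂ ℕ._+_ (cong ind (≢⇒≡ᵇ≡false p a p≢a))
                     (occurrences-range-∈ (suc a) k (ℕₚ.≤∧≢⇒< a≤p (p≢a ∘ ≡.sym))
                                                    (≡.subst (p <_) (ℕₚ.+-suc a k) p<a+k)))

shift : Bool → ℕ → ℕ
shift false = id
shift true  = suc

shorten : Bool → ℕ → ℕ
shorten false m = m
shorten true  m = m ∸ 1

-- edges (Tf m n) is definitionally  grid false true ++ grid true false ++ grid true true
-- over the ranges  range 1 (shorten s m)  and  range 1 (shorten t n).
grid : Bool → Bool → List ℕ → List ℕ → List Edge
grid s t is js = concatMap (λ i → map (λ j → ((i , j) , (shift s i , shift t j))) js) is

incidence : Vertex → Edge → ℕ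
incidence v e = ind ((v =ᵥ proj₁ e) ∨ (v =ᵥ proj₂ e))

grid-ends-distinct : ∀ s t → T (s ∨ t) → ∀ p q i j →
                     ((p ≡ᵇ i) ∧ (p ≡ᵇ shift s i) ≡ false) ⊎ ((q ≡ᵇ j) ∧ (q ≡ᵇ shift t j) ≡ false)
grid-ends-distinct true  t     _ p q i j = inj₁ (≡ᵇ-suc-disjoint p i)
grid-ends-distinct false true  _ p q i j = inj₂ (≡ᵇ-suc-disjoint q j)

sum-incidence-grid : ∀ s t → T (s ∨ t) → ∀ p q is js →
  ℕΣ.sumMap (incidence (p , q)) (grid s t is js)
    ≡ occurrences id is p ℕ.* occurrences id js q ℕ.+ occurrences (shift s) is p ℕ.* occurrences (shift t) js q
sum-incidence-grid s t s∨t p q is js = begin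
    sumMap ι (concatMap (λ i → map (end i) js) is)                   ≡⟨ sumMap-concatMap ι _ is ⟩
    sumMap (λ i → sumMap ι (map (end i) js)) is                      ≡⟨ sumMap-cong is (λ i → sumMap-map ι (end i) js) ⟩
    sumMap (λ i → sumMap (λ j → ι (end i j)) js) is                  ≡⟨ sumMap-cong is row ⟩
    sumMap (λ i → ind (p ≡ᵇ i) ℕ.* Q ℕ.+ ind (p ≡ᵇ shift s i) ℕ.* Q′) is
      ≡⟨ ≡.trans (sumMap-+ (λ i → ind (p ≡ᵇ i) ℕ.* Q) (λ i → ind (p ≡ᵇ shift s i) ℕ.* Q′) is)
                 (cong₂ ℕ._+_ (sumMap-*ʳ Q (λ i → ind (p ≡ᵇ i)) is)
                              (sumMap-*ʳ Q′ (λ i → ind (p ≡ᵇ shift s i)) is)) ⟩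
    occurrences id is p ℕ.* Q ℕ.+ occurrences (shift s) is p ℕ.* Q′  ∎
  where
  open ℕΣ
  open ≡.≡-Reasoning
  ι = incidence (p , q)
  end : ℕ → ℕ → Edge
  end i j = ((i , j) , (shift s i , shift t j))
  Q Q′ : ℕ
  Q  = occurrences id js q
  Q′ = occurrences (shift t) js q
  row : ∀ i → sumMap (λ j → ι (end i j)) js ≡ ind (p ≡ᵇ i) ℕ.* Q ℕ.+ ind (p ≡ᵇ shift s i) ℕ.* Q′
  row i = ≡.trans (sumMap-cong js (λ j → ind-∨-∧ (p ≡ᵇ i) (q ≡ᵇ j) (p ≡ᵇ shift s i) (q ≡ᵇ shift t j)
                                                   (grid-ends-distinct s t s∨t p q i j)))
         (≡.trans (sumMap-+ (λ j → ind (p ≡ᵇ i) ℕ.* ind (q ≡ᵇ j))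
                            (λ j → ind (p ≡ᵇ shift s i) ℕ.* ind (q ≡ᵇ shift t j)) js)
                  (cong₂ ℕ._+_ (sumMap-*ˡ (ind (p ≡ᵇ i)) (λ j → ind (q ≡ᵇ j)) js)
                               (sumMap-*ˡ (ind (p ≡ᵇ shift s i)) (λ j → ind (q ≡ᵇ shift t j)) js)))

Profile : Set
Profile = ℕ × ℕ × ℕ

-- Whether p lies in 1..M, has a successor there, and has a predecessor there.
profile : ℕ → ℕ → Profile
profile M p = occurrences id (range 1 M) p , occurrences id (range 1 (M ∸ 1)) p , occurrences suc (range 1 (M ∸ 1)) p

first middle last : Profile
first  = 1 , 1 , 0
middle = 1 , 1 , 1
last   = 1 , 0 , 1

-- The three summands count horizontal, vertical and diagonal neighbours.
degreeOf : Profile → Profile → ℕ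
degreeOf (x₁ , x₂ , x₃) (y₁ , y₂ , y₃) =
  (x₁ ℕ.* y₂ ℕ.+ x₁ ℕ.* y₃) ℕ.+ ((x₂ ℕ.* y₁ ℕ.+ x₃ ℕ.* y₁) ℕ.+ (x₂ ℕ.* y₂ ℕ.+ x₃ ℕ.* y₃))

deg-Tf : ∀ m n p q → deg (Tf m n) (p , q) ≡ degreeOf (profile m p) (profile n q)
deg-Tf m n p q =
  ≡.trans (ℕΣ.sumMap-++ ι E₁ (E₂ ++ E₃))
          (cong₂ ℕ._+_ (sum-incidence-grid false true _ p q (range 1 m) (range 1 (n ∸ 1)))
            (≡.trans (ℕΣ.sumMap-++ ι E₂ E₃)
                     (cong₂ ℕ._+_ (sum-incidence-grid true false _ p q (range 1 (m ∸ 1)) (range 1 n))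
                                  (sum-incidence-grid true true _ p q (range 1 (m ∸ 1)) (range 1 (n ∸ 1))))))
  where
  ι = incidence (p , q)
  E₁ = grid false true (range 1 m) (range 1 (n ∸ 1))
  E₂ = grid true false (range 1 (m ∸ 1)) (range 1 n)
  E₃ = grid true true (range 1 (m ∸ 1)) (range 1 (n ∸ 1))

-- In the third component,  occurrences suc L (suc p)  reduces to  occurrences id L p.
profile-first : ∀ k → profile (3 ℕ.+ k) 1 ≡ first
profile-first k =
  cong₂ _,_ (occurrences-range-∈ 1 (3 ℕ.+ k) ℕₚ.≤-refl (s≤s (s≤s z≤n)))
  (cong₂ _,_ (occurrences-range-∈ 1 (2 ℕ.+ k) ℕₚ.≤-refl (s≤s (s≤s z≤n)))
             (occurrences-range-∉ 1 (2 ℕ.+ k) (inj₁ (s≤s z≤n))))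

profile-middle : ∀ k i → 2 ≤ i → i ≤ 2 ℕ.+ k → profile (3 ℕ.+ k) i ≡ middle
profile-middle k (suc i) (s≤s 1≤i) i<2+k =
  cong₂ _,_ (occurrences-range-∈ 1 (3 ℕ.+ k) (s≤s z≤n) (s≤s (ℕₚ.m≤n⇒m≤1+n i<2+k)))
  (cong₂ _,_ (occurrences-range-∈ 1 (2 ℕ.+ k) (s≤s z≤n) (s≤s i<2+k))
             (occurrences-range-∈ 1 (2 ℕ.+ k) 1≤i (ℕₚ.m<n⇒m<1+n i<2+k)))

profile-last : ∀ k → profile (3 ℕ.+ k) (3 ℕ.+ k) ≡ last
profile-last k =
  cong₂ _,_ (occurrences-range-∈ 1 (3 ℕ.+ k) (s≤s z≤n) (ℕₚ.n<1+n _))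
  (cong₂ _,_ (occurrences-range-∉ 1 (2 ℕ.+ k) (inj₂ ℕₚ.≤-refl))
             (occurrences-range-∈ 1 (2 ℕ.+ k) (s≤s z≤n) (ℕₚ.n<1+n _)))

-- N and m + n − 5 for m = 3 + a, n = 3 + b.
N′ s′ : ℕ → ℕ → ℕ
N′ a b = 3 ℕ.* (a ℕ.* b) ℕ.+ (a ℕ.+ b)
s′ a b = suc (a ℕ.+ b)

module Partition {c ℓ} (S : CommutativeSemiring c ℓ) where
  open CommutativeSemiring S renaming (refl to ≈-refl)
  open import Relation.Binary.Reasoning.Setoid setoid
  open ListSum S
  open NaturalCoefficients S using (solve; _:=_; con; _:+_; _:*_)

  axisSum : Bool → ℕ → (Profile → Profile → Carrier) → Carrier
  axisSum false k F = F first first  + nat (suc k) * F middle middle + F last last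
  axisSum true  k F = F first middle + nat k       * F middle middle + F middle last

  sum-axis : ∀ s k (F : Profile → Profile → Carrier) →
             sumMap (λ i → F (profile (3 ℕ.+ k) i) (profile (3 ℕ.+ k) (shift s i))) (range 1 (shorten s (3 ℕ.+ k)))
               ≈ axisSum s k F
  sum-axis false k F = begin
    sumMap f (range 1 (3 ℕ.+ k))                    ≈⟨ sumMap-range-ends f 1 (suc k) ⟩
    f 1 + sumMap f (range 2 (suc k)) + f (3 ℕ.+ k)
      ≈⟨ +-cong (+-cong f-first (sumMap-range-const f 2 (suc k) f-middle)) f-last ⟩
    axisSum false k F                               ∎
    where
    f : ℕ → Carrier
    f i = F (profile (3 ℕ.+ k) i) (profile (3 ℕ.+ k) i)
    f-first : f 1 ≈ F first first
    f-first = reflexive (cong₂ F (profile-first k) (profile-first k))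
    f-middle : ∀ i → 2 ≤ i → i < 2 ℕ.+ suc k → f i ≈ F middle middle
    f-middle i 2≤i i<3+k = reflexive (cong₂ F middleᵢ middleᵢ)
      where middleᵢ = profile-middle k i 2≤i (ℕₚ.≤-pred i<3+k)
    f-last : f (3 ℕ.+ k) ≈ F last last
    f-last = reflexive (cong₂ F (profile-last k) (profile-last k))
  sum-axis true k F = begin
    sumMap f (range 1 (2 ℕ.+ k))                ≈⟨ sumMap-range-ends f 1 k ⟩
    f 1 + sumMap f (range 2 k) + f (2 ℕ.+ k)
      ≈⟨ +-cong (+-cong f-first (sumMap-range-const f 2 k f-middle)) f-last ⟩
    axisSum true k F                            ∎
    where
    f : ℕ → Carrier
    f i = F (profile (3 ℕ.+ k) i) (profile (3 ℕ.+ k) (suc i))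
    f-first : f 1 ≈ F first middle
    f-first = reflexive (cong₂ F (profile-first k) (profile-middle k 2 ℕₚ.≤-refl (s≤s (s≤s z≤n))))
    f-middle : ∀ i → 2 ≤ i → i < 2 ℕ.+ k → f i ≈ F middle middle
    f-middle i 2≤i i<2+k = reflexive (cong₂ F (profile-middle k i 2≤i (ℕₚ.<⇒≤ i<2+k))
                                              (profile-middle k (suc i) (ℕₚ.m≤n⇒m≤1+n 2≤i) i<2+k))
    f-last : f (2 ℕ.+ k) ≈ F middle last
    f-last = reflexive (cong₂ F (profile-middle k (2 ℕ.+ k) (s≤s (s≤s z≤n)) ℕₚ.≤-refl) (profile-last k))

  module _ (a b : ℕ) where
    private
      m n : ℕ
      m = 3 ℕ.+ a
      n = 3 ℕ.+ b
      G : Graph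
      G = Tf m n

    sum-grid : ∀ s t {A : Set} (P : ℕ → ℕ → A) (φ : A → Carrier)
               (F : Profile → Profile → Profile → Profile → Carrier) →
               (∀ i j → φ (P i j) ≈ F (profile m i) (profile m (shift s i)) (profile n j) (profile n (shift t j))) →
               sumMap φ (concatMap (λ i → map (P i) (range 1 (shorten t n))) (range 1 (shorten s m)))
                 ≈ axisSum s a (λ X X′ → axisSum t b (F X X′))
    sum-grid s t P φ F φ≈F = begin
      sumMap φ (concatMap (λ i → map (P i) js) is)       ≈⟨ sumMap-concatMap φ (λ i → map (P i) js) is ⟩
      sumMap (λ i → sumMap φ (map (P i) js)) is          ≈⟨ sumMap-cong is row ⟩
      sumMap (λ i → axisSum t b (F (pm i) (pm (shift s i)))) is
                                                         ≈⟨ sum-axis s a (λ X X′ → axisSum t b (F X X′)) ⟩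
      axisSum s a (λ X X′ → axisSum t b (F X X′))        ∎
      where
      is = range 1 (shorten s m)
      js = range 1 (shorten t n)
      pm pn : ℕ → Profile
      pm = profile m
      pn = profile n
      row : ∀ i → sumMap φ (map (P i) js) ≈ axisSum t b (F (pm i) (pm (shift s i)))
      row i = begin
        sumMap φ (map (P i) js)                                          ≈⟨ sumMap-map φ (P i) js ⟩
        sumMap (φ ∘ P i) js                                              ≈⟨ sumMap-cong js (φ≈F i) ⟩
        sumMap (λ j → F (pm i) (pm (shift s i)) (pn j) (pn (shift t j))) js ≈⟨ sum-axis t b (F (pm i) (pm (shift s i))) ⟩
        axisSum t b (F (pm i) (pm (shift s i)))                          ∎

    vertexForm : (ℕ → Carrier) → Carrier
    vertexForm g = nat 2 * g 2 + nat 2 * g 3 + nat 2 * (nat (suc a) + nat (suc b)) * g 4 + nat (suc a) * nat (suc b) * g 6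

    edgeForm : (ℕ → ℕ → Carrier) → Carrier
    edgeForm h = nat 2 * (h 2 4 + h 4 2) + nat 2 * (h 3 4 + h 4 3) + (h 3 6 + h 6 3)
               + nat 2 * nat (s′ a b) * (h 4 4 + h 4 6 + h 6 4) + nat (N′ a b) * h 6 6

    vertexForm-cong : ∀ {g g′ : ℕ → Carrier} → (∀ d → .{{NonZero d}} → g d ≈ g′ d) →
                      vertexForm g ≈ vertexForm g′
    vertexForm-cong g≈g′ =
      +-cong (+-cong (+-cong (*-congˡ (g≈g′ 2)) (*-congˡ (g≈g′ 3))) (*-congˡ (g≈g′ 4))) (*-congˡ (g≈g′ 6))

    edgeForm-cong : ∀ {h h′ : ℕ → ℕ → Carrier} →
                    (∀ x y → .{{NonZero x}} → .{{NonZero y}} → h x y ≈ h′ x y) → edgeForm h ≈ edgeForm h′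
    edgeForm-cong h≈h′ =
      +-cong (+-cong (+-cong (+-cong (*-congˡ (+-cong (h≈h′ 2 4) (h≈h′ 4 2)))
                                     (*-congˡ (+-cong (h≈h′ 3 4) (h≈h′ 4 3))))
                             (+-cong (h≈h′ 3 6) (h≈h′ 6 3)))
                     (*-congˡ (+-cong (+-cong (h≈h′ 4 4) (h≈h′ 4 6)) (h≈h′ 6 4))))
             (*-congˡ (h≈h′ 6 6))

    nat-s′ : nat (s′ a b) ≈ 1# + (nat a + nat b)
    nat-s′ = +-congˡ (nat-+ a b)

    nat-N′ : nat (N′ a b) ≈ nat 3 * (nat a * nat b) + (nat a + nat b)
    nat-N′ = trans (nat-+ (3 ℕ.* (a ℕ.* b)) (a ℕ.+ b))
                   (+-cong (trans (nat-* 3 (a ℕ.* b)) (*-congˡ (nat-* a b))) (nat-+ a b))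

    vertex-partition : ∀ (g : ℕ → Carrier) → sumMap (λ v → g (deg G v)) (verts G) ≈ vertexForm g
    vertex-partition g = begin
      sumMap (λ v → g (deg G v)) (verts G)
        ≈⟨ sum-grid false false _,_ (λ v → g (deg G v)) (λ X _ Y _ → g (degreeOf X Y))
                    (λ i j → reflexive (cong g (deg-Tf m n i j))) ⟩
      axisSum false a (λ X _ → axisSum false b (λ Y _ → g (degreeOf X Y)))
        ≈⟨ collect (nat a) (nat b) (g 2) (g 3) (g 4) (g 6) ⟩
      vertexForm g ∎
      where
      -- degreeOf on {first, middle, last}² is 3 4 2 / 4 6 4 / 2 4 3.
      collect = solve 6 (λ A B g₂ g₃ g₄ g₆ →
        let A₁ = con 1 :+ A ; B₁ = con 1 :+ B in
        (g₃ :+ B₁ :* g₄ :+ g₂) :+ A₁ :* (g₄ :+ B₁ :* g₆ :+ g₄) :+ (g₂ :+ B₁ :* g₄ :+ g₃)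
        := natP 2 :* g₂ :+ natP 2 :* g₃ :+ natP 2 :* (A₁ :+ B₁) :* g₄ :+ A₁ :* B₁ :* g₆) ≈-refl

    edge-partition : ∀ (h : ℕ → ℕ → Carrier) →
                     sumMap (λ e → h (deg G (proj₁ e)) (deg G (proj₂ e))) (edges G) ≈ edgeForm h
    edge-partition h = begin
      sumMap φ (E₁ ++ E₂ ++ E₃)
        ≈⟨ trans (sumMap-++ φ E₁ (E₂ ++ E₃)) (+-congˡ (sumMap-++ φ E₂ E₃)) ⟩
      sumMap φ E₁ + (sumMap φ E₂ + sumMap φ E₃)
        ≈⟨ +-cong (family false true) (+-cong (family true false) (family true true)) ⟩
      axisSum false a (λ X X′ → axisSum true b (F X X′)) + (axisSum true a (λ X X′ → axisSum false b (F X X′))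
        + axisSum true a (λ X X′ → axisSum true b (F X X′)))
        ≈⟨ collect (nat a) (nat b) (h 2 4) (h 4 2) (h 3 4) (h 4 3) (h 3 6) (h 6 3) (h 4 4) (h 4 6) (h 6 4) (h 6 6) ⟩
      _ ≈⟨ +-cong (+-congˡ (*-congʳ (*-congˡ nat-s′))) (*-congʳ nat-N′) ⟨
      edgeForm h ∎
      where
      φ : Edge → Carrier
      φ e = h (deg G (proj₁ e)) (deg G (proj₂ e))
      E₁ = grid false true (range 1 m) (range 1 (n ∸ 1))
      E₂ = grid true false (range 1 (m ∸ 1)) (range 1 n)
      E₃ = grid true true (range 1 (m ∸ 1)) (range 1 (n ∸ 1))
      F : Profile → Profile → Profile → Profile → Carrier
      F X X′ Y Y′ = h (degreeOf X Y) (degreeOf X′ Y′)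
      family : ∀ s t → sumMap φ (grid s t (range 1 (shorten s m)) (range 1 (shorten t n)))
                         ≈ axisSum s a (λ X X′ → axisSum t b (F X X′))
      family s t = sum-grid s t (λ i j → ((i , j) , (shift s i , shift t j))) φ F
                            (λ i j → reflexive (cong₂ h (deg-Tf m n i j) (deg-Tf m n (shift s i) (shift t j))))
      collect = solve 12 (λ A B h₂₄ h₄₂ h₃₄ h₄₃ h₃₆ h₆₃ h₄₄ h₄₆ h₆₄ h₆₆ →
        let A₁ = con 1 :+ A ; B₁ = con 1 :+ B in
        ((h₃₄ :+ B :* h₄₄ :+ h₄₂) :+ A₁ :* (h₄₆ :+ B :* h₆₆ :+ h₆₄) :+ (h₂₄ :+ B :* h₄₄ :+ h₄₃))
        :+ (((h₃₄ :+ B₁ :* h₄₆ :+ h₂₄) :+ A :* (h₄₄ :+ B₁ :* h₆₆ :+ h₄₄) :+ (h₄₂ :+ B₁ :* h₆₄ :+ h₄₃))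
        :+ ((h₃₆ :+ B :* h₄₆ :+ h₄₄) :+ A :* (h₄₆ :+ B :* h₆₆ :+ h₆₄) :+ (h₄₄ :+ B :* h₆₄ :+ h₆₃)))
        := natP 2 :* (h₂₄ :+ h₄₂) :+ natP 2 :* (h₃₄ :+ h₄₃) :+ (h₃₆ :+ h₆₃)
           :+ natP 2 :* (con 1 :+ (A :+ B)) :* (h₄₄ :+ h₄₆ :+ h₆₄) :+ (natP 3 :* (A :* B) :+ (A :+ B)) :* h₆₆) ≈-refl

Nℤ-3+ : ∀ a b → Nℤ (3 ℕ.+ a) (3 ℕ.+ b) ≡ + N′ a b
Nℤ-3+ a b = ≡.trans (expand (+ a) (+ b))
  (≡.sym (cong (ℤ._+ (+ a ℤ.+ + b)) (≡.trans (ℤₚ.pos-* 3 (a ℕ.* b)) (cong (+ 3 ℤ.*_) (ℤₚ.pos-* a b)))))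
  where
  open Data.Integer.Solver.+-*-Solver
  expand = solve 2 (λ A B →
    con (+ 3) :* ((con (+ 3) :+ A) :* (con (+ 3) :+ B) :+ con (+ 7)) :- con (+ 8) :* ((con (+ 3) :+ A) :+ (con (+ 3) :+ B))
    := con (+ 3) :* (A :* B) :+ (A :+ B)) refl

S5-3+ : ∀ a b → S5 (3 ℕ.+ a) (3 ℕ.+ b) ≡ + s′ a b
S5-3+ a b = expand (+ a) (+ b)
  where
  open Data.Integer.Solver.+-*-Solver
  expand = solve 2 (λ A B → (con (+ 3) :+ A) :+ (con (+ 3) :+ B) :- con (+ 5) := con (+ 1) :+ (A :+ B)) refl

pos-N′-s′ : ∀ a b k₁ k₂ k₃ →
            + (k₁ ℕ.* N′ a b ℕ.+ k₂ ℕ.* s′ a b ℕ.+ k₃)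
              ≡ + k₁ ℤ.* Nℤ (3 ℕ.+ a) (3 ℕ.+ b) ℤ.+ + k₂ ℤ.* S5 (3 ℕ.+ a) (3 ℕ.+ b) ℤ.+ + k₃
pos-N′-s′ a b k₁ k₂ k₃ =
  cong₂ (λ x y → x ℤ.+ y ℤ.+ + k₃)
    (≡.trans (ℤₚ.pos-* k₁ (N′ a b)) (cong (+ k₁ ℤ.*_) (≡.sym (Nℤ-3+ a b))))
    (≡.trans (ℤₚ.pos-* k₂ (s′ a b)) (cong (+ k₂ ℤ.*_) (≡.sym (S5-3+ a b))))

module NaturalIndices (a b : ℕ) where
  open Partition ℕₚ.+-*-commutativeSemiring
  open ListSum ℕₚ.+-*-commutativeSemiring using (nat)
  open Data.Nat.Solver.+-*-Solver
  open ≡.≡-Reasoning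

  private
    G : Graph
    G = Tf (3 ℕ.+ a) (3 ℕ.+ b)

  nat≡id : ∀ k → nat k ≡ k
  nat≡id zero    = refl
  nat≡id (suc k) = cong suc (nat≡id k)

  vertexForm-ℕ : ∀ g → vertexForm a b g ≡ 2 ℕ.* g 2 ℕ.+ 2 ℕ.* g 3 ℕ.+ 2 ℕ.* (suc a ℕ.+ suc b) ℕ.* g 4
                                          ℕ.+ suc a ℕ.* suc b ℕ.* g 6
  vertexForm-ℕ g = cong₂ (λ x y → 2 ℕ.* g 2 ℕ.+ 2 ℕ.* g 3 ℕ.+ 2 ℕ.* (suc x ℕ.+ suc y) ℕ.* g 4
                                 ℕ.+ suc x ℕ.* suc y ℕ.* g 6)
                        (nat≡id a) (nat≡id b)

  edgeForm-ℕ : ∀ h → edgeForm a b h ≡ 2 ℕ.* (h 2 4 ℕ.+ h 4 2) ℕ.+ 2 ℕ.* (h 3 4 ℕ.+ h 4 3) ℕ.+ (h 3 6 ℕ.+ h 6 3)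
                                      ℕ.+ 2 ℕ.* s′ a b ℕ.* (h 4 4 ℕ.+ h 4 6 ℕ.+ h 6 4) ℕ.+ N′ a b ℕ.* h 6 6
  edgeForm-ℕ h = cong₂ (λ x y → 2 ℕ.* (h 2 4 ℕ.+ h 4 2) ℕ.+ 2 ℕ.* (h 3 4 ℕ.+ h 4 3) ℕ.+ (h 3 6 ℕ.+ h 6 3)
                               ℕ.+ 2 ℕ.* x ℕ.* (h 4 4 ℕ.+ h 4 6 ℕ.+ h 6 4) ℕ.+ y ℕ.* h 6 6)
                      (nat≡id (s′ a b)) (nat≡id (N′ a b))

  private
    vertexFormₚ : (ℕ → ℕ) → Polynomial 2 → Polynomial 2 → Polynomial 2
    vertexFormₚ g A B = con 2 :* con (g 2) :+ con 2 :* con (g 3) :+ con 2 :* ((con 1 :+ A) :+ (con 1 :+ B)) :* con (g 4)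
                        :+ (con 1 :+ A) :* (con 1 :+ B) :* con (g 6)

    edgeFormₚ : (ℕ → ℕ → ℕ) → Polynomial 2 → Polynomial 2 → Polynomial 2
    edgeFormₚ h S N = con 2 :* (con (h 2 4) :+ con (h 4 2)) :+ con 2 :* (con (h 3 4) :+ con (h 4 3)) :+ (con (h 3 6) :+ con (h 6 3))
                      :+ con 2 :* S :* (con (h 4 4) :+ con (h 4 6) :+ con (h 6 4)) :+ N :* con (h 6 6)

    N′ₚ s′ₚ : Polynomial 2 → Polynomial 2 → Polynomial 2
    N′ₚ A B = con 3 :* (A :* B) :+ (A :+ B)
    s′ₚ A B = con 1 :+ (A :+ B)

  M₁-Tf : M₁ G ≡ 12 ℕ.* N′ a b ℕ.+ 56 ℕ.* s′ a b ℕ.+ 70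
  M₁-Tf = begin
    M₁ G                  ≡⟨ vertex-partition a b g ⟩
    vertexForm a b g      ≡⟨ vertexForm-ℕ g ⟩
    _                     ≡⟨ solve 2 (λ A B → vertexFormₚ g A B := con 12 :* N′ₚ A B :+ con 56 :* s′ₚ A B :+ con 70) refl a b ⟩
    12 ℕ.* N′ a b ℕ.+ 56 ℕ.* s′ a b ℕ.+ 70 ∎
    where g = λ d → d ℕ.^ 2

  F-Tf : Fidx G ≡ 72 ℕ.* N′ a b ℕ.+ 272 ℕ.* s′ a b ℕ.+ 270
  F-Tf = begin
    Fidx G                ≡⟨ vertex-partition a b g ⟩
    vertexForm a b g      ≡⟨ vertexForm-ℕ g ⟩
    _                     ≡⟨ solve 2 (λ A B → vertexFormₚ g A B := con 72 :* N′ₚ A B :+ con 272 :* s′ₚ A B :+ con 270) refl a b ⟩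
    72 ℕ.* N′ a b ℕ.+ 272 ℕ.* s′ a b ℕ.+ 270 ∎
    where g = λ d → d ℕ.^ 3

  M₂-Tf : M₂ G ≡ 36 ℕ.* N′ a b ℕ.+ 128 ℕ.* s′ a b ℕ.+ 116
  M₂-Tf = begin
    M₂ G                  ≡⟨ edge-partition a b h ⟩
    edgeForm a b h        ≡⟨ edgeForm-ℕ h ⟩
    _                     ≡⟨ solve 2 (λ S N → edgeFormₚ h S N := con 36 :* N :+ con 128 :* S :+ con 116) refl (s′ a b) (N′ a b) ⟩
    36 ℕ.* N′ a b ℕ.+ 128 ℕ.* s′ a b ℕ.+ 116 ∎
    where h = ℕ._*_

  ReZM-Tf : ReZM G ≡ 432 ℕ.* N′ a b ℕ.+ 1216 ℕ.* s′ a b ℕ.+ 852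
  ReZM-Tf = begin
    ReZM G                ≡⟨ edge-partition a b h ⟩
    edgeForm a b h        ≡⟨ edgeForm-ℕ h ⟩
    _                     ≡⟨ solve 2 (λ S N → edgeFormₚ h S N := con 432 :* N :+ con 1216 :* S :+ con 852) refl (s′ a b) (N′ a b) ⟩
    432 ℕ.* N′ a b ℕ.+ 1216 ℕ.* s′ a b ℕ.+ 852 ∎
    where h = λ x y → x ℕ.* y ℕ.* (x ℕ.+ y)

module Exponential {c ℓ} (R : CommutativeRing c ℓ) (X : ExpStructure R) where
  open CommutativeRing R renaming (refl to ≈-refl)
  open ExpStructure X
  open ExpOps R X
  open import Relation.Binary.Reasoning.Setoid setoid
  open ListSum commutativeSemiring using (nat; natP)
  open Partition commutativeSemiring
  open NaturalCoefficients commutativeSemiring using (solve; _:=_; con; _:+_; _:*_)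

  fromℕ≡nat : ∀ k → fromℕ R k ≡ nat k
  fromℕ≡nat zero    = refl
  fromℕ≡nat (suc k) = cong (λ x → 1# + x) (fromℕ≡nat k)

  pow-pred : ∀ x .{{_ : NonZero x}} α → pow x α ≈ pow x (α − 1#) * fromℕ R x
  pow-pred x α = begin
    pow x α                      ≈⟨ pow-cong x α−1+1≈α ⟨
    pow x ((α − 1#) + 1#)        ≈⟨ pow-+ x (α − 1#) 1# ⟩
    pow x (α − 1#) * pow x 1#    ≈⟨ *-congˡ (pow-1 x) ⟩
    pow x (α − 1#) * fromℕ R x   ∎
    where
    α−1+1≈α : (α − 1#) + 1# ≈ α
    α−1+1≈α = trans (+-assoc α (- 1#) 1#) (trans (+-congˡ (-‿inverseˡ 1#)) (+-identityʳ α))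

  pow-fromℕ-* : ∀ x .{{_ : NonZero x}} k α → pow x (fromℕ R (suc k) * α) ≈ pow (x ℕ.^ suc k) α
  pow-fromℕ-* x zero α = begin
    pow x ((1# + 0#) * α)   ≈⟨ pow-cong x (trans (*-congʳ (+-identityʳ 1#)) (*-identityˡ α)) ⟩
    pow x α                 ≡⟨ cong (λ y → pow y α) (≡.sym (ℕₚ.*-identityʳ x)) ⟩
    pow (x ℕ.* 1) α         ∎
  pow-fromℕ-* x {{x≢0}} (suc k) α = begin
    pow x ((1# + fromℕ R (suc k)) * α)          ≈⟨ pow-cong x (trans (distribʳ α 1# _) (+-congʳ (*-identityˡ α))) ⟩
    pow x (α + fromℕ R (suc k) * α)             ≈⟨ pow-+ x α _ ⟩
    pow x α * pow x (fromℕ R (suc k) * α)       ≈⟨ *-congˡ (pow-fromℕ-* x k α) ⟩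
    pow x α * pow (x ℕ.^ suc k) α               ≈⟨ pow-* x (x ℕ.^ suc k) {{x≢0}} {{ℕₚ.m^n≢0 x (suc k)}} α ⟨
    pow (x ℕ.^ suc (suc k)) α                   ∎

  module _ (a b : ℕ) where
    private
      m n : ℕ
      m = 3 ℕ.+ a
      n = 3 ℕ.+ b
      G : Graph
      G = Tf m n

    fromℤ-N : fromℤ (Nℤ m n) ≡ nat (N′ a b)
    fromℤ-N = ≡.trans (cong fromℤ (Nℤ-3+ a b)) (fromℕ≡nat (N′ a b))

    fromℤ-s : fromℤ (S5 m n) ≡ nat (s′ a b)
    fromℤ-s = ≡.trans (cong fromℤ (S5-3+ a b)) (fromℕ≡nat (s′ a b))

    Mᵃ-Tf : ∀ α →
      Mᵃ α G ≈
        fromℕᴿ 2 * fromℤ (Nℤ m n) * pow 6 (α − 1#)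
        + fromℕᴿ 2 * (pow 3 (α − 1#) + pow 6 (α − 1#))
        + fromℕᴿ 4 * (pow 3 (α − 1#) + pow 4 (α − 1#))
        + fromℕᴿ 4 * (pow 2 (α − 1#) + pow 2 (fromℕᴿ 2 * (α − 1#)))
        + fromℤ (S5 m n) * (pow 2 (fromℕᴿ 2 * α) + fromℕᴿ 4 * (pow 4 (α − 1#) + pow 6 (α − 1#)))
    Mᵃ-Tf α = begin
      Mᵃ α G                                         ≈⟨ vertex-partition a b (λ d → pow d α) ⟩
      vertexForm a b (λ d → pow d α)                 ≈⟨ vertexForm-cong a b (λ d → pow-pred d α) ⟩
      vertexForm a b (λ d → pow d α′ * fromℕ R d)
        ≈⟨ collect (nat a) (nat b) (pow 2 α′) (pow 3 α′) (pow 4 α′) (pow 6 α′) ⟩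
      _ ≈⟨ +-cong (+-cong (+-congʳ (+-congʳ (*-congʳ (*-congˡ N≈)))) (*-congˡ (+-congˡ pow-2-2α′)))
                  (*-cong s≈ (+-congʳ pow-2-2α)) ⟨
      _ ∎
      where
      α′ = α − 1#
      N≈ : fromℤ (Nℤ m n) ≈ nat 3 * (nat a * nat b) + (nat a + nat b)
      N≈ = trans (reflexive fromℤ-N) (nat-N′ a b)
      s≈ : fromℤ (S5 m n) ≈ 1# + (nat a + nat b)
      s≈ = trans (reflexive fromℤ-s) (nat-s′ a b)
      pow-2-2α′ : pow 2 (fromℕᴿ 2 * α′) ≈ pow 4 α′
      pow-2-2α′ = pow-fromℕ-* 2 1 α′
      pow-2-2α : pow 2 (fromℕᴿ 2 * α) ≈ pow 4 α′ * fromℕ R 4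
      pow-2-2α = trans (pow-fromℕ-* 2 1 α) (pow-pred 4 α)
      collect = solve 6 (λ A B u t v w →
        let A₁ = con 1 :+ A ; B₁ = con 1 :+ B in
        natP 2 :* (u :* natP 2) :+ natP 2 :* (t :* natP 3) :+ natP 2 :* (A₁ :+ B₁) :* (v :* natP 4)
        :+ A₁ :* B₁ :* (w :* natP 6)
        := natP 2 :* (natP 3 :* (A :* B) :+ (A :+ B)) :* w :+ natP 2 :* (t :+ w) :+ natP 4 :* (t :+ v) :+ natP 4 :* (u :+ v)
           :+ (con 1 :+ (A :+ B)) :* (v :* natP 4 :+ natP 4 :* (v :+ w))) ≈-refl

    Rₐ-Tf : ∀ α →
      Rₐ α G ≈
        fromℤ (Nℤ m n) * pow 6 (fromℕᴿ 2 * α)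
        + fromℕᴿ 4 * pow 2 (fromℕᴿ 3 * α)
        + fromℤ (S5 m n) * pow 2 (fromℕᴿ 4 * α + 1#)
        + fromℕᴿ 2 * pow 3 α * pow 6 α
        + fromℕᴿ 4 * fromℤ (S5 m n) * pow 4 α * pow 6 α
        + fromℕᴿ 4 * pow 3 α * pow 4 α
    Rₐ-Tf α = begin
      Rₐ α G                                           ≈⟨ edge-partition a b (λ x y → pow (x ℕ.* y) α) ⟩
      edgeForm a b (λ x y → pow (x ℕ.* y) α)           ≈⟨ edgeForm-cong a b (λ x y → pow-* x y α) ⟩
      edgeForm a b (λ x y → pow x α * pow y α)
        ≈⟨ collect (nat (s′ a b)) (nat (N′ a b)) (pow 2 α) (pow 3 α) (pow 4 α) (pow 6 α) ⟩
      _ ≈⟨ +-congʳ (+-cong (+-congʳ (+-cong (+-cong (*-cong (reflexive fromℤ-N) pow-6-2α) (*-congˡ pow-2-3α))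
                                            (*-cong (reflexive fromℤ-s) pow-2-4α+1)))
                           (*-congʳ (*-congʳ (*-congˡ (reflexive fromℤ-s))))) ⟨
      _ ∎
      where
      pow-6-2α : pow 6 (fromℕᴿ 2 * α) ≈ pow 6 α * pow 6 α
      pow-6-2α = trans (pow-fromℕ-* 6 1 α) (pow-* 6 6 α)
      pow-2-3α : pow 2 (fromℕᴿ 3 * α) ≈ pow 2 α * pow 4 α
      pow-2-3α = trans (pow-fromℕ-* 2 2 α) (pow-* 2 4 α)
      pow-2-4α+1 : pow 2 (fromℕᴿ 4 * α + 1#) ≈ pow 4 α * pow 4 α * fromℕ R 2
      pow-2-4α+1 = trans (pow-+ 2 _ 1#) (*-cong (trans (pow-fromℕ-* 2 3 α) (pow-* 4 4 α)) (pow-1 2))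
      collect = solve 6 (λ S N p₂ p₃ p₄ p₆ →
        natP 2 :* (p₂ :* p₄ :+ p₄ :* p₂) :+ natP 2 :* (p₃ :* p₄ :+ p₄ :* p₃) :+ (p₃ :* p₆ :+ p₆ :* p₃)
        :+ natP 2 :* S :* (p₄ :* p₄ :+ p₄ :* p₆ :+ p₆ :* p₄) :+ N :* (p₆ :* p₆)
        := N :* (p₆ :* p₆) :+ natP 4 :* (p₂ :* p₄) :+ S :* (p₄ :* p₄ :* natP 2) :+ natP 2 :* p₃ :* p₆
           :+ natP 4 :* S :* p₄ :* p₆ :+ natP 4 :* p₃ :* p₄) ≈-refl

module Rational (a b : ℕ) where
  open ListSum (CommutativeRing.commutativeSemiring ℚₚ.+-*-commutativeRing) using (nat; nat-*)
  open Partition (CommutativeRing.commutativeSemiring ℚₚ.+-*-commutativeRing)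
  open Data.Rational.Solver.+-*-Solver
  open ≡.≡-Reasoning

  private
    m n : ℕ
    m = 3 ℕ.+ a
    n = 3 ℕ.+ b

  /1≡nat : ∀ k → (+ k) ℚ./ 1 ≡ nat k
  /1≡nat zero    = refl
  /1≡nat (suc k) = begin
    (+ 1 ℤ.+ + k) ℚ./ 1               ≡⟨ cong (λ z → (+ 1 ℤ.+ z) ℚ./ 1) (≡.sym (ℤₚ.*-identityʳ (+ k))) ⟩
    ℚ.1ℚ ℚ.+ ℚ.mkℚ (+ k) 0 k⊥1        ≡⟨ cong (ℚ.1ℚ ℚ.+_) (ℚₚ.normalize-coprime k⊥1) ⟨
    ℚ.1ℚ ℚ.+ (+ k) ℚ./ 1              ≡⟨ cong (ℚ.1ℚ ℚ.+_) (/1≡nat k) ⟩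
    nat (suc k)                       ∎
    where
    k⊥1 = Coprimality.sym (Coprimality.1-coprimeTo k)

  SDD-Tf : SDD (Tf m n) ≡ (+ 2 ℤ.* Nℤ m n) ℚ./ 1 ℚ.+ (+ 38 ℚ./ 3) ℚ.* (S5 m n ℚ./ 1) ℚ.+ (+ 70 ℚ./ 3)
  SDD-Tf = begin
    SDD (Tf m n)                  ≡⟨ edge-partition a b h ⟩
    edgeForm a b h                ≡⟨ collect (nat (s′ a b)) (nat (N′ a b)) ⟩
    nat 2 ℚ.* nat (N′ a b) ℚ.+ (+ 38 ℚ./ 3) ℚ.* nat (s′ a b) ℚ.+ (+ 70 ℚ./ 3)
      ≡⟨ cong₂ (λ x y → x ℚ.+ (+ 38 ℚ./ 3) ℚ.* y ℚ.+ (+ 70 ℚ./ 3)) 2N≡ s≡ ⟨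
    (+ 2 ℤ.* Nℤ m n) ℚ./ 1 ℚ.+ (+ 38 ℚ./ 3) ℚ.* (S5 m n ℚ./ 1) ℚ.+ (+ 70 ℚ./ 3) ∎
    where
    h : ℕ → ℕ → ℚ
    h x y = frac x y ℚ.+ frac y x
    2N≡ : (+ 2 ℤ.* Nℤ m n) ℚ./ 1 ≡ nat 2 ℚ.* nat (N′ a b)
    2N≡ = begin
      (+ 2 ℤ.* Nℤ m n) ℚ./ 1     ≡⟨ cong (λ z → (+ 2 ℤ.* z) ℚ./ 1) (Nℤ-3+ a b) ⟩
      (+ 2 ℤ.* + N′ a b) ℚ./ 1   ≡⟨ cong (ℚ._/ 1) (ℤₚ.pos-* 2 (N′ a b)) ⟨
      (+ (2 ℕ.* N′ a b)) ℚ./ 1   ≡⟨ /1≡nat (2 ℕ.* N′ a b) ⟩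
      nat (2 ℕ.* N′ a b)         ≡⟨ nat-* 2 (N′ a b) ⟩
      nat 2 ℚ.* nat (N′ a b)     ∎
    s≡ : S5 m n ℚ./ 1 ≡ nat (s′ a b)
    s≡ = ≡.trans (cong (ℚ._/ 1) (S5-3+ a b)) (/1≡nat (s′ a b))
    collect = solve 2 (λ S N →
      con (nat 2) :* (con (h 2 4) :+ con (h 4 2)) :+ con (nat 2) :* (con (h 3 4) :+ con (h 4 3)) :+ (con (h 3 6) :+ con (h 6 3))
      :+ con (nat 2) :* S :* (con (h 4 4) :+ con (h 4 6) :+ con (h 6 4)) :+ N :* con (h 6 6)
      := con (nat 2) :* N :+ con (+ 38 ℚ./ 3) :* S :+ con (+ 70 ℚ./ 3)) refl

corollary4 : ∀ {c ℓ : Level} (R : CommutativeRing c ℓ) (X : ExpStructure R)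
  (m n : ℕ) → 3 ≤ m → 3 ≤ n →
  let G = Tf m n
      N = Nℤ m n
      s = S5 m n
  in
  -- (i)
  (+ M₁ G ≡ + 12 ℤ.* N ℤ.+ + 56 ℤ.* s ℤ.+ + 70)
  -- (ii)
  × (+ M₂ G ≡ + 36 ℤ.* N ℤ.+ + 128 ℤ.* s ℤ.+ + 116)
  -- (iii)
  × (+ Fidx G ≡ + 72 ℤ.* N ℤ.+ + 272 ℤ.* s ℤ.+ + 270)
  -- (iv)
  × (+ ReZM G ≡ + 432 ℤ.* N ℤ.+ + 1216 ℤ.* s ℤ.+ + 852)
  -- (v)
  × (let open CommutativeRing R
         open ExpStructure X
         open ExpOps R X
     in ∀ (a : Carrier) → ¬ (a ≈ 0#) → ¬ (a ≈ 1#) →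
        Mᵃ a G ≈
          fromℕᴿ 2 * fromℤ N * pow 6 (a − 1#)
          + fromℕᴿ 2 * (pow 3 (a − 1#) + pow 6 (a − 1#))
          + fromℕᴿ 4 * (pow 3 (a − 1#) + pow 4 (a − 1#))
          + fromℕᴿ 4 * (pow 2 (a − 1#) + pow 2 (fromℕᴿ 2 * (a − 1#)))
          + fromℤ s * (pow 2 (fromℕᴿ 2 * a)
                       + fromℕᴿ 4 * (pow 4 (a − 1#) + pow 6 (a − 1#))))
  -- (vi)
  × (let open CommutativeRing R
         open ExpStructure X
         open ExpOps R X
     in ∀ (a : Carrier) → ¬ (a ≈ 0#) →
        Rₐ a G ≈
          fromℤ N * pow 6 (fromℕᴿ 2 * a)
          + fromℕᴿ 4 * pow 2 (fromℕᴿ 3 * a)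
          + fromℤ s * pow 2 (fromℕᴿ 4 * a + 1#)
          + fromℕᴿ 2 * pow 3 a * pow 6 a
          + fromℕᴿ 4 * fromℤ s * pow 4 a * pow 6 a
          + fromℕᴿ 4 * pow 3 a * pow 4 a)
  -- (vii)
  × (SDD G ≡ (+ 2 ℤ.* N) ℚ./ 1 ℚ.+ (+ 38 ℚ./ 3) ℚ.* (s ℚ./ 1) ℚ.+ (+ 70 ℚ./ 3))
corollary4 R X (suc (suc (suc a))) (suc (suc (suc b))) (s≤s (s≤s (s≤s _))) (s≤s (s≤s (s≤s _))) =
  ≡.trans (cong +_ M₁-Tf) (pos-N′-s′ a b 12 56 70) ,
  ≡.trans (cong +_ M₂-Tf) (pos-N′-s′ a b 36 128 116) ,
  ≡.trans (cong +_ F-Tf) (pos-N′-s′ a b 72 272 270) ,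
  ≡.trans (cong +_ ReZM-Tf) (pos-N′-s′ a b 432 1216 852) ,
  (λ α _ _ → Exponential.Mᵃ-Tf R X a b α) ,
  (λ α _ → Exponential.Rₐ-Tf R X a b α) ,
  Rational.SDD-Tf a b
  where open NaturalIndices a b
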